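{- Let $R(3,n)$ be a family of $3$-bisequences on an $n$-element set $X$ with Property $V$, and let $b,c,d,x,y,z$ denote elements of $X$ (distinct within each bisequence). Then: (i) if $\{bxy;\emptyset\}$ and $\{bxz;\emptyset\}$ are in $R(3,n)$, then $\{byz;\emptyset\}$ is not; (ii) if $\{bxz;\emptyset\}$ and $\{byz;\emptyset\}$ are in $R(3,n)$, then $\{bxy;\emptyset\}$ is not; (iii) if $\{bx;c\}$ and $\{bx;d\}$ are in $R(3,n)$, then $\{dx;c\}$ is not; (iv) if $\{bx;c\}$ and $\{dx;c\}$ are in $R(3,n)$, then $\{dx;b\}$ is not.
   Context: A $d$-bisequence on a set $X$ is a pair $\{a_1;a_2\}$ of sequences of elements of $X$, one of length $i$ and the other of length $d-i$ for some $i\in[0,d]$, such that the $d$ elements occurring in them are distinct; its reversal is $\{a_2;a_1\}$. Notation: $\{bxy;\emptyset\}$ is the bisequence whose first sequence is $(b,x,y)$ and whose second is empty; $\{bx;c\}$ has first sequence $(b,x)$ and second sequence $(c)$. An initial segment of $\{a_1;a_2\}$ is the set of the first $j$ elements of $a_1$ or of $a_2$, $j\in[1,d]$. A family $R(d,n)$ of $d$-bisequences on an $n$-element set has Property $V$ if: (1) for all $w,x\in R(d,n)$, if $L$ is an initial segment of $w$ and all elements of $L$ occur in $x$, then $L$ is an initial segment of one of the sequences of $x$, with its elements in the same order as in $w$; (2) a bisequence and its reversal are not both in $R(d,n)$. -}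

module Defs where

open import Data.Nat using (ℕ; suc; _+_; _≤_)
open import Data.Fin using (Fin)
open import Data.List using (List; []; _∷_; length; take)
open import Data.List.Relation.Unary.All using (All)
open import Data.List.Relation.Unary.Unique.Propositional using (Unique)
open import Data.List.Membership.Propositional using (_∈_)
open import Data.Product using (_×_)
open import Data.Sum using (_⊎_)
open import Relation.Binary.PropositionalEquality using (_≡_)
open import Relation.Nullary using (¬_)

IsBisequence : {X : Set} → ℕ → List X → List X → Set
IsBisequence d a₁ a₂ = (length a₁ + length a₂ ≡ d) × Unique (a₁ Data.List.++ a₂)

OccursIn : {X : Set} → X → List X → List X → Set
OccursIn x b₁ b₂ = x ∈ b₁ ⊎ x ∈ b₂

IsPrefixOf : {X : Set} → List X → List X → Set
IsPrefixOf p s = (length p ≤ length s) × (take (length p) s ≡ p)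

record PropertyV {X : Set} (d : ℕ) (R : List X → List X → Set) : Set where
  field
    bisequences : ∀ a₁ a₂ → R a₁ a₂ → IsBisequence d a₁ a₂
    -- The case of initial segments of a₂ is covered by (1) applied with
    -- the sequences of w swapped (condition (1) is stated for both sides).
    initial₁ : ∀ a₁ a₂ b₁ b₂ j → R a₁ a₂ → R b₁ b₂ → 1 ≤ j → j ≤ length a₁ →
               All (λ e → OccursIn e b₁ b₂) (take j a₁) →
               IsPrefixOf (take j a₁) b₁ ⊎ IsPrefixOf (take j a₁) b₂
    initial₂ : ∀ a₁ a₂ b₁ b₂ j → R a₁ a₂ → R b₁ b₂ → 1 ≤ j → j ≤ length a₂ →
               All (λ e → OccursIn e b₁ b₂) (take j a₂) →
               IsPrefixOf (take j a₂) b₁ ⊎ IsPrefixOf (take j a₂) b₂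
    noReversal : ∀ a₁ a₂ → R a₁ a₂ → ¬ R a₂ a₁

module Submission where

open import Defs
open import Data.Nat using (ℕ; z≤n; s≤s)
open import Data.Fin using (Fin)
open import Data.List using (List; []; _∷_)
open import Data.List.Properties using (∷-injectiveˡ; ∷-injectiveʳ)
open import Data.List.Relation.Unary.All using ([]; _∷_)
open import Data.List.Relation.Unary.Any using (here; there)
open import Data.List.Relation.Unary.AllPairs using (_∷_)
open import Data.Product using (_×_; _,_; proj₂)
open import Data.Sum using (_⊎_; inj₁; inj₂)
open import Relation.Binary.PropositionalEquality using (refl)
open import Relation.Nullary using (¬_)

-- All four parts reduce to two incompatibilities: {bxy;∅} with {byz;∅}, and
-- {bx;d} with {dx;c}. In each, the initial segment by (resp. dx) of the second
-- member occurs in the first, so by condition (1) it is an initial segment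
-- there in the same order, forcing x = y (resp. b = d) against distinctness.

module _ {X : Set} {d : ℕ} {R : List X → List X → Set} (V : PropertyV d R) where
  open PropertyV V

  initialPair-isPrefix : ∀ {p q s t b₁ b₂} → R (p ∷ q ∷ s) t → R b₁ b₂ →
                         OccursIn p b₁ b₂ → OccursIn q b₁ b₂ →
                         IsPrefixOf (p ∷ q ∷ []) b₁ ⊎ IsPrefixOf (p ∷ q ∷ []) b₂
  initialPair-isPrefix u w p∈w q∈w =
    initial₁ _ _ _ _ 2 u w (s≤s z≤n) (s≤s (s≤s z≤n)) (p∈w ∷ q∈w ∷ [])

-- The paper's bisequence {a₁;a₂} is written a₁∥a₂ in names.
module _ {X : Set} {R : List X → List X → Set} (V : PropertyV 3 R) where
  open PropertyV V

  ¬-bxy∥-byz∥ : ∀ {b x y z} → R (b ∷ x ∷ y ∷ []) [] → ¬ R (b ∷ y ∷ z ∷ []) []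
  ¬-bxy∥-byz∥ w u
    with proj₂ (bisequences _ _ w)
       | initialPair-isPrefix V u w (inj₁ (here refl)) (inj₁ (there (there (here refl))))
  ... | _ ∷ (x≢y ∷ []) ∷ _ | inj₁ (_ , bx≡by) = x≢y (∷-injectiveˡ (∷-injectiveʳ bx≡by))
  ... | _                  | inj₂ (() , _)

  ¬-bx∥d-dx∥c : ∀ {b c d x} → R (b ∷ x ∷ []) (d ∷ []) → ¬ R (d ∷ x ∷ []) (c ∷ [])
  ¬-bx∥d-dx∥c w u
    with proj₂ (bisequences _ _ w)
       | initialPair-isPrefix V u w (inj₂ (here refl)) (inj₁ (there (here refl)))
  ... | (_ ∷ b≢d ∷ []) ∷ _ | inj₁ (_ , bx≡dx) = b≢d (∷-injectiveˡ bx≡dx)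
  ... | _                  | inj₂ (s≤s () , _)

lemma12 : (n : ℕ) (R : List (Fin n) → List (Fin n) → Set) → PropertyV 3 R →
          (∀ b x y z → R (b ∷ x ∷ y ∷ []) [] → R (b ∷ x ∷ z ∷ []) [] → ¬ R (b ∷ y ∷ z ∷ []) [])
          × (∀ b x y z → R (b ∷ x ∷ z ∷ []) [] → R (b ∷ y ∷ z ∷ []) [] → ¬ R (b ∷ x ∷ y ∷ []) [])
          × (∀ b c d x → R (b ∷ x ∷ []) (c ∷ []) → R (b ∷ x ∷ []) (d ∷ []) → ¬ R (d ∷ x ∷ []) (c ∷ []))
          × (∀ b c d x → R (b ∷ x ∷ []) (c ∷ []) → R (d ∷ x ∷ []) (c ∷ []) → ¬ R (d ∷ x ∷ []) (b ∷ []))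
lemma12 n R V =
    (λ b x y z bxy∥ _ → ¬-bxy∥-byz∥ V bxy∥)
  , (λ b x y z _ byz∥ bxy∥ → ¬-bxy∥-byz∥ V bxy∥ byz∥)
  , (λ b c d x _ bx∥d → ¬-bx∥d-dx∥c V bx∥d)
  , (λ b c d x bx∥c _ dx∥b → ¬-bx∥d-dx∥c V dx∥b bx∥c)
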